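{- Let $D=(d_1,\dots,d_n)$ be a graphic degree sequence. Then (a) $\max\big(|\mathbb G(\mathcal D^{++}_D)|,|\mathbb G(\mathcal D^{ -- }_D)|\big)\le n^2\big(|\mathbb G(\mathcal D^{+- }_D)|+|\mathcal G(D)|\big)$; (b) $\max\big(|\mathbb G(\mathcal D^{+2}_D)|,|\mathbb G(\mathcal D^{ -2}_D)|\big)\le n^2\,|\mathbb G(\mathcal D^{+- }_D)|$; (c) $|\mathbb G(\mathcal D^{+- }_D)|\le (n^4+n^2)\min\big(|\mathbb G(\mathcal D^{++}_D)|,|\mathbb G(\mathcal D^{ -- }_D)|\big)$.
   Context: For an integer sequence $E$ of length $n$, $\mathcal G(E)$ is the set of simple graphs on the labelled vertex set $\{v_1,\dots,v_n\}$ with $\deg(v_i)=e_i$ (empty if some entry is negative); for a family $\mathcal F$ of sequences, $\mathbb G(\mathcal F)=\bigcup_{E\in\mathcal F}\mathcal G(E)$. For indices $i,j$, $1^{\pm i}_{\pm j}$ denotes the vector with $\pm1$ added at coordinate $i$ and $\pm1$ at coordinate $j$ (zeros elsewhere). Define $\mathcal D^{+- }_D=\{D+1^{+i}_{ -j}:1\le i\ne j\le n\}$, $\mathcal D^{++}_D=\{D+1^{+i}_{+j}:1\le i\ne j\le n\}$, $\mathcal D^{ -- }_D=\{D+1^{ -i}_{ -j}:1\le i\ne j\le n\}$, $\mathcal D^{+2}_D=\{D+1^{+i}_{+i}:1\le i\le n\}$ (adding $2$ to coordinate $i$), $\mathcal D^{ -2}_D=\{D+1^{ -i}_{ -i}:1\le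 i\le n\}$. -}

module Defs where

open import Data.Bool using (Bool; true; false; _∧_; _∨_; not)
open import Data.Nat using (ℕ; zero; suc; _<ᵇ_; _<_)
open import Data.Fin using (Fin; toℕ)
import Data.Fin as Fin
open import Data.Integer as ℤ using (ℤ; +_; -[1+_])
open import Data.List using (List; []; _∷_; _++_; map; concatMap; length; filterᵇ; allFin)
open import Data.Bool.ListAction using (all; any)
open import Data.Product using (_×_; _,_; proj₁; proj₂)
open import Relation.Nullary.Decidable using (does)

-- Simple graphs on the labelled vertex set Fin n are identified with
-- subsets of the set of unordered pairs {i,j}, i ≠ j, each pair
-- represented once as (i , j) with toℕ i < toℕ j.
Edge : ℕ → Set
Edge n = Fin n × Fin n

pairs : (n : ℕ) → List (Edge n)
pairs n = concatMap (λ i → concatMap (λ j → if' (toℕ i <ᵇ toℕ j) ((i , j) ∷ []) []) (allFin n)) (allFin n)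
  where
  if' : {A : Set} → Bool → A → A → A
  if' true  x _ = x
  if' false _ y = y

subs : {A : Set} → List A → List (List A)
subs [] = [] ∷ []
subs (x ∷ xs) = subs xs ++ map (x ∷_) (subs xs)

Graph : ℕ → Set
Graph n = List (Edge n)

allGraphs : (n : ℕ) → List (Graph n)
allGraphs n = subs (pairs n)

_==_ : {n : ℕ} → Fin n → Fin n → Bool
i == j = does (i Fin.≟ j)

degree : {n : ℕ} → Graph n → Fin n → ℕ
degree g v = length (filterᵇ (λ e → (v == proj₁ e) ∨ (v == proj₂ e)) g)

Seq : ℕ → Set
Seq n = Fin n → ℤ

hasDegrees : {n : ℕ} → Graph n → Seq n → Bool
hasDegrees {n} g E = all (λ k → does ((+ degree g k) ℤ.≟ E k)) (allFin n)

Family : ℕ → Set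
Family n = Seq n → Bool

cardG : {n : ℕ} → Seq n → ℕ
cardG {n} E = length (filterᵇ (λ g → hasDegrees g E) (allGraphs n))

-- |𝔾(ℱ)| = |⋃_{E∈ℱ} 𝒢(E)| = number of graphs whose degree sequence lies in ℱ
cardGG : {n : ℕ} → Family n → ℕ
cardGG {n} F = length (filterᵇ (λ g → F (λ k → + degree g k)) (allGraphs n))

ind : {n : ℕ} → Fin n → ℤ → Fin n → ℤ
ind i a k with i == k
... | true  = a
... | false = + 0

perturb : {n : ℕ} → Seq n → ℤ → Fin n → ℤ → Fin n → Seq n
perturb D a i b j k = D k ℤ.+ ind i a k ℤ.+ ind j b k

seqEq : {n : ℕ} → Seq n → Seq n → Bool
seqEq {n} E F = all (λ k → does (E k ℤ.≟ F k)) (allFin n)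

plus1 minus1 : ℤ
plus1 = + 1
minus1 = -[1+ 0 ]

offDiagFamily : {n : ℕ} → Seq n → ℤ → ℤ → Family n
offDiagFamily {n} D a b E =
  any (λ i → any (λ j → not (i == j) ∧ seqEq E (perturb D a i b j)) (allFin n)) (allFin n)

diagFamily : {n : ℕ} → Seq n → ℤ → Family n
diagFamily {n} D a E = any (λ i → seqEq E (perturb D a i a i)) (allFin n)

𝒟pm 𝒟pp 𝒟mm 𝒟p2 𝒟m2 : {n : ℕ} → Seq n → Family n
𝒟pm D = offDiagFamily D plus1 minus1
𝒟pp D = offDiagFamily D plus1 plus1
𝒟mm D = offDiagFamily D minus1 minus1
𝒟p2 D = diagFamily D plus1
𝒟m2 D = diagFamily D minus1

toSeq : {n : ℕ} → (Fin n → ℕ) → Seq n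
toSeq d k = + d k

Graphic : {n : ℕ} → (Fin n → ℕ) → Set
Graphic D = 0 < cardG (toSeq D)

{-# OPTIONS --safe #-}
-- Each graph G counted on the left of (a)–(c) is m H for a graph H counted on the right
-- and a move m from a fixed list: toggling one pair ab (n² choices), and in (c) also
-- toggling the three pairs of a path a–b–c–d (n⁴ choices).  H is recovered from G by the
-- same toggles; e.g. deleting an edge iu from a graph with degrees D + 1ᵢ + 1ⱼ leaves
-- degrees D + 1ⱼ − 1ᵤ, or D when u = j.  In (c), when no single toggle works, a suitable
-- path exists, since otherwise the neighbourhood of i (resp. j) would be comparable with
-- its neighbourhood in a realisation of D although the two degrees differ by 2.

module Submission where

open import Defs
open import Data.Nat using (ℕ; _+_; _*_; _^_; _≤_; _⊔_; _⊓_)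
open import Data.Fin using (Fin)
open import Data.Product using (_×_)

open import Data.Nat using (zero; suc; z≤n; s≤s; _<_; _<ᵇ_)
import Data.Nat.Properties as ℕ
open import Data.Fin using (toℕ)
import Data.Fin as Fin
import Data.Fin.Properties as Fin
open import Data.Bool using (Bool; true; false; T; _∧_; _∨_; not; _xor_; if_then_else_)
import Data.Bool.Properties as Bool
open import Data.List using (List; []; _∷_; _++_; map; length; filterᵇ; allFin; tabulate; concatMap; cartesianProduct; cartesianProductWith)
open import Data.Product using (∃; ∃₂; _,_; proj₁; proj₂)
open import Data.Integer as ℤ using (ℤ; +_)
import Data.Integer.Properties as ℤ
open import Data.Integer.Tactic.RingSolver using (solve-∀)
open import Data.Sum using (_⊎_; inj₁; inj₂)
open import Data.Empty using (⊥-elim)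
open import Function using (_∘_; _$_; id; Equivalence)
open import Relation.Nullary using (¬_; Dec; yes; no; does)
open import Relation.Nullary.Decidable using (dec-true; dec-false; T?; ¬?; _×-dec_)
open import Data.List.Membership.Propositional using (_∈_; _∉_; _─_; find; lose)
import Data.List.Membership.Propositional.Properties as ∈
open import Data.List.Relation.Binary.Subset.Propositional using (_⊆_)
open import Data.List.Relation.Unary.Any as Any using (here; there)
import Data.List.Relation.Unary.All as All
import Data.List.Relation.Unary.All.Properties as All
import Data.List.Relation.Unary.Any.Properties as Any
open import Data.List.Relation.Unary.AllPairs using ([]; _∷_)
open import Data.List.Relation.Unary.Unique.Propositional using (Unique)
import Data.List.Relation.Unary.Unique.Propositional.Properties as Unique
import Data.List.Properties as List
open import Data.List.Relation.Binary.Disjoint.Propositional using (Disjoint)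
open import Relation.Binary.PropositionalEquality
open import Relation.Binary.Definitions using (DecidableEquality; tri<; tri≈; tri>)
import Data.Product.Properties as ×
open import Algebra.Properties.CommutativeSemigroup ℕ.+-commutativeSemigroup using (x∙yz≈y∙xz)

-- Counting over Fin n

bit : Bool → ℕ
bit false = 0
bit true  = 1

count : {n : ℕ} → (Fin n → Bool) → ℕ
count {zero}  f = 0
count {suc n} f = bit (f Fin.zero) + count (f ∘ Fin.suc)

count-cong : {n : ℕ} {f g : Fin n → Bool} → (∀ u → f u ≡ g u) → count f ≡ count g
count-cong {zero}  f≗g = refl
count-cong {suc n} f≗g = cong₂ _+_ (cong bit (f≗g Fin.zero)) (count-cong (f≗g ∘ Fin.suc))

count-mono : {n : ℕ} {f g : Fin n → Bool} → (∀ u → f u ≡ true → g u ≡ true) → count f ≤ count g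
count-mono {zero}  f⊆g = z≤n
count-mono {suc n} f⊆g = ℕ.+-mono-≤ (bit-mono (f⊆g Fin.zero)) (count-mono (f⊆g ∘ Fin.suc))
  where
  bit-mono : {a b : Bool} → (a ≡ true → b ≡ true) → bit a ≤ bit b
  bit-mono {false} _   = z≤n
  bit-mono {true}  a⇒b rewrite a⇒b refl = ℕ.≤-refl

count-complement : {n : ℕ} (f : Fin n → Bool) → count f + count (not ∘ f) ≡ n
count-complement {zero}  f = refl
count-complement {suc n} f with f Fin.zero
... | true  = cong suc (count-complement (f ∘ Fin.suc))
... | false = trans (ℕ.+-suc (count (f ∘ Fin.suc)) _) (cong suc (count-complement (f ∘ Fin.suc)))

count-witness : {n : ℕ} (f : Fin n → Bool) → 1 ≤ count f → ∃ λ u → f u ≡ true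
count-witness {suc n} f 1≤c with f Fin.zero in eq
... | true  = Fin.zero , eq
... | false = let u , fu = count-witness (f ∘ Fin.suc) 1≤c in Fin.suc u , fu

count-positive : {n : ℕ} {f : Fin n → Bool} (u : Fin n) → f u ≡ true → 1 ≤ count f
count-positive {suc n} {f} Fin.zero    fu rewrite fu = s≤s z≤n
count-positive {suc n} {f} (Fin.suc u) fu =
  ℕ.≤-trans (count-positive {f = f ∘ Fin.suc} u fu) (ℕ.m≤n+m _ (bit (f Fin.zero)))

length-filter-tabulate : {A : Set} {n : ℕ} (p : A → Bool) (h : Fin n → A) →
  length (filterᵇ p (tabulate h)) ≡ count (p ∘ h)
length-filter-tabulate {n = zero}  p h = refl
length-filter-tabulate {n = suc n} p h with p (h Fin.zero)
... | true  = cong suc (length-filter-tabulate p (h ∘ Fin.suc))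
... | false = length-filter-tabulate p (h ∘ Fin.suc)

_∖_ : {n : ℕ} → (Fin n → Bool) → Fin n → Fin n → Bool
(f ∖ b) u = f u ∧ not (u == b)

count-split : {n : ℕ} (f : Fin n → Bool) (b : Fin n) → count f ≡ bit (f b) + count (f ∖ b)
count-split {suc n} f Fin.zero =
  cong₂ (λ x y → bit (f Fin.zero) + (bit x + y))
    (sym (Bool.∧-zeroʳ (f Fin.zero))) (count-cong (λ u → sym (Bool.∧-identityʳ (f (Fin.suc u)))))
count-split {suc n} f (Fin.suc b) = begin
  bit (f Fin.zero) + count (f ∘ Fin.suc)
    ≡⟨ cong (_+_ (bit (f Fin.zero))) (count-split (f ∘ Fin.suc) b) ⟩
  bit (f Fin.zero) + (bit (f (Fin.suc b)) + count ((f ∘ Fin.suc) ∖ b))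
    ≡⟨ x∙yz≈y∙xz (bit (f Fin.zero)) (bit (f (Fin.suc b))) _ ⟩
  bit (f (Fin.suc b)) + (bit (f Fin.zero) + count ((f ∘ Fin.suc) ∖ b))
    ≡⟨ cong (λ x → bit (f (Fin.suc b)) + (bit x + count ((f ∘ Fin.suc) ∖ b))) (sym (Bool.∧-identityʳ (f Fin.zero))) ⟩
  bit (f (Fin.suc b)) + count (f ∖ Fin.suc b) ∎
  where open ≡-Reasoning

-- Lengths of lists, sublists

module _ {A : Set} where

  ∈-─ : {x y : A} {ys : List A} (x∈ys : x ∈ ys) → y ∈ ys → y ≢ x → y ∈ ys ─ x∈ys
  ∈-─ (here refl) (here refl)  y≢x = ⊥-elim (y≢x refl)
  ∈-─ (here refl) (there y∈ys) _   = y∈ys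
  ∈-─ (there _)   (here y≡z)   _   = here y≡z
  ∈-─ (there x∈ys) (there y∈ys) y≢x = there (∈-─ x∈ys y∈ys y≢x)

  length-mono-⊆ : {xs ys : List A} → Unique xs → xs ⊆ ys → length xs ≤ length ys
  length-mono-⊆ {[]}     []            _     = z≤n
  length-mono-⊆ {x ∷ xs} {ys} (x∉xs ∷ u) xs⊆ys = begin
    suc (length xs)          ≤⟨ s≤s (length-mono-⊆ u xs⊆ys─x) ⟩
    suc (length (ys ─ x∈ys)) ≡⟨ sym (List.length-removeAt′ ys (Any.index x∈ys)) ⟩
    length ys                ∎
    where
    open ℕ.≤-Reasoning
    x∈ys : x ∈ ys
    x∈ys = xs⊆ys (here refl)
    xs⊆ys─x : xs ⊆ ys ─ x∈ys
    xs⊆ys─x y∈xs = ∈-─ x∈ys (xs⊆ys (there y∈xs)) (λ { refl → All.lookup x∉xs y∈xs refl })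

  length-filter-∨ : (p q : A → Bool) (xs : List A) →
    length (filterᵇ (λ x → p x ∨ q x) xs) ≤ length (filterᵇ p xs) + length (filterᵇ q xs)
  length-filter-∨ p q [] = z≤n
  length-filter-∨ p q (x ∷ xs) with p x | q x
  ... | true  | true  = s≤s (ℕ.≤-trans (length-filter-∨ p q xs) (ℕ.+-monoʳ-≤ _ (ℕ.n≤1+n _)))
  ... | true  | false = s≤s (length-filter-∨ p q xs)
  ... | false | true  = ℕ.≤-trans (s≤s (length-filter-∨ p q xs)) (ℕ.≤-reflexive (sym (ℕ.+-suc _ _)))
  ... | false | false = length-filter-∨ p q xs

∈-nonempty : {A : Set} {xs : List A} → 0 < length xs → ∃ (_∈ xs)
∈-nonempty {xs = x ∷ _} _ = x , here refl

length-cartesianProductWith : {A B C : Set} (f : A → B → C) (xs : List A) (ys : List B) →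
  length (cartesianProductWith f xs ys) ≡ length xs * length ys
length-cartesianProductWith f []       ys = refl
length-cartesianProductWith f (x ∷ xs) ys = begin
  length (map (f x) ys ++ cartesianProductWith f xs ys)
    ≡⟨ List.length-++ (map (f x) ys) ⟩
  length (map (f x) ys) + length (cartesianProductWith f xs ys)
    ≡⟨ cong₂ _+_ (List.length-map (f x) ys) (length-cartesianProductWith f xs ys) ⟩
  length ys + length xs * length ys ∎
  where open ≡-Reasoning

module _ {A : Set} (U : List A) where

  Covered : List (A → A) → (A → Bool) → A → Set
  Covered moves Q x = ∃₂ λ m y → m ∈ moves × y ∈ U × T (Q y) × m y ≡ x

  covering-bound : Unique U → (moves : List (A → A)) (P Q : A → Bool) →
    (∀ {x} → x ∈ U → T (P x) → Covered moves Q x) →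
    length (filterᵇ P U) ≤ length moves * length (filterᵇ Q U)
  covering-bound uU moves P Q cover = begin
    length (filterᵇ P U)                                   ≤⟨ length-mono-⊆ (Unique.filter⁺ (T? ∘ P) uU) P⊆moves[Q] ⟩
    length (cartesianProductWith _$_ moves (filterᵇ Q U))  ≡⟨ length-cartesianProductWith _$_ moves _ ⟩
    length moves * length (filterᵇ Q U)                    ∎
    where
    open ℕ.≤-Reasoning
    P⊆moves[Q] : filterᵇ P U ⊆ cartesianProductWith _$_ moves (filterᵇ Q U)
    P⊆moves[Q] x∈P with ∈.∈-filter⁻ (T? ∘ P) x∈P
    ... | x∈U , Px with cover x∈U Px
    ... | m , y , m∈moves , y∈U , Qy , refl =
      ∈.∈-cartesianProductWith⁺ _$_ m∈moves (∈.∈-filter⁺ (T? ∘ Q) y∈U Qy)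

Unique-concatMap : {A B : Set} {f : A → List B} (key : B → A) {xs : List A} → Unique xs →
  (∀ x → Unique (f x)) → (∀ x {y} → y ∈ f x → key y ≡ x) → Unique (concatMap f xs)
Unique-concatMap key {[]}     []         _       _      = []
Unique-concatMap {f = f} key {x ∷ xs} (x∉xs ∷ u) uniqueᶠ keyᶠ =
  Unique.++⁺ (uniqueᶠ x) (Unique-concatMap key u uniqueᶠ keyᶠ) disjoint
  where
  disjoint : Disjoint (f x) (concatMap f xs)
  disjoint (y∈fx , y∈rest) with find (∈.∈-concatMap⁻ f {xs = xs} y∈rest)
  ... | x′ , x′∈xs , y∈fx′ = All.lookup x∉xs x′∈xs (trans (sym (keyᶠ x y∈fx)) (keyᶠ x′ y∈fx′))

module _ {A : Set} where

  subs-⊆ : {xs g : List A} → g ∈ subs xs → g ⊆ xs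
  subs-⊆ {[]}     (here refl) ()
  subs-⊆ {x ∷ xs} g∈ y∈g with ∈.∈-++⁻ (subs xs) g∈
  ... | inj₁ g∈subs = there (subs-⊆ g∈subs y∈g)
  ... | inj₂ g∈x∷subs with ∈.∈-map⁻ (x ∷_) g∈x∷subs
  ...   | g′ , g′∈subs , refl with y∈g
  ...     | here y≡x    = here y≡x
  ...     | there y∈g′ = there (subs-⊆ g′∈subs y∈g′)

  Unique-∈-subs : {xs g : List A} → Unique xs → g ∈ subs xs → Unique g
  Unique-∈-subs {[]}     _          (here refl) = []
  Unique-∈-subs {x ∷ xs} (x∉xs ∷ u) g∈ with ∈.∈-++⁻ (subs xs) g∈
  ... | inj₁ g∈subs = Unique-∈-subs u g∈subs
  ... | inj₂ g∈x∷subs with ∈.∈-map⁻ (x ∷_) g∈x∷subs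
  ...   | g′ , g′∈subs , refl = All.tabulate (λ y∈g′ → All.lookup x∉xs (subs-⊆ g′∈subs y∈g′)) ∷ Unique-∈-subs u g′∈subs

  Unique-subs : {xs : List A} → Unique xs → Unique (subs xs)
  Unique-subs {[]}     _          = All.[] ∷ []
  Unique-subs {x ∷ xs} (x∉xs ∷ u) =
    Unique.++⁺ (Unique-subs u) (Unique.map⁺ List.∷-injectiveʳ (Unique-subs u)) disjoint
    where
    disjoint : Disjoint (subs xs) (map (x ∷_) (subs xs))
    disjoint (g∈subs , g∈x∷subs) with ∈.∈-map⁻ (x ∷_) g∈x∷subs
    ... | _ , _ , refl = All.lookup x∉xs (subs-⊆ g∈subs (here refl)) refl

  filter-∈-subs : (p : A → Bool) (xs : List A) → filterᵇ p xs ∈ subs xs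
  filter-∈-subs p [] = here refl
  filter-∈-subs p (x ∷ xs) with p x
  ... | true  = ∈.∈-++⁺ʳ (subs xs) (∈.∈-map⁺ (x ∷_) (filter-∈-subs p xs))
  ... | false = ∈.∈-++⁺ˡ (filter-∈-subs p xs)

  subs-ext : {xs g h : List A} → Unique xs → g ∈ subs xs → h ∈ subs xs →
    g ⊆ h → h ⊆ g → g ≡ h
  subs-ext {[]} _ (here refl) (here refl) _ _ = refl
  subs-ext {x ∷ xs} (x∉xs ∷ u) g∈ h∈ g⊆h h⊆g
    with ∈.∈-++⁻ (subs xs) g∈ | ∈.∈-++⁻ (subs xs) h∈
  ... | inj₁ g∈subs | inj₁ h∈subs = subs-ext u g∈subs h∈subs g⊆h h⊆g
  ... | inj₁ g∈subs | inj₂ h∈x∷subs with ∈.∈-map⁻ (x ∷_) h∈x∷subs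
  ...   | _ , _ , refl = ⊥-elim (All.lookup x∉xs (subs-⊆ g∈subs (h⊆g (here refl))) refl)
  subs-ext {x ∷ xs} (x∉xs ∷ u) g∈ h∈ g⊆h h⊆g | inj₂ g∈x∷subs | inj₁ h∈subs with ∈.∈-map⁻ (x ∷_) g∈x∷subs
  ...   | _ , _ , refl = ⊥-elim (All.lookup x∉xs (subs-⊆ h∈subs (g⊆h (here refl))) refl)
  subs-ext {x ∷ xs} (x∉xs ∷ u) g∈ h∈ g⊆h h⊆g | inj₂ g∈x∷subs | inj₂ h∈x∷subs
    with ∈.∈-map⁻ (x ∷_) g∈x∷subs | ∈.∈-map⁻ (x ∷_) h∈x∷subs
  ... | g′ , g′∈subs , refl | h′ , h′∈subs , refl =
    cong (x ∷_) (subs-ext u g′∈subs h′∈subs (drop-x g′∈subs g⊆h) (drop-x h′∈subs h⊆g))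
    where
    drop-x : {k k′ : List A} → k ∈ subs xs → x ∷ k ⊆ x ∷ k′ → k ⊆ k′
    drop-x k∈subs k⊆k′ y∈k with k⊆k′ (there y∈k)
    ... | here refl   = ⊥-elim (All.lookup x∉xs (subs-⊆ k∈subs y∈k) refl)
    ... | there y∈k′ = y∈k′

-- Graphs as sublists of the vertex pairs

does-sound : {P : Set} (d : Dec P) → T (does d) → P
does-sound (yes p) _ = p

does-complete : {P : Set} (d : Dec P) → P → T (does d)
does-complete (yes _)  _ = _
does-complete (no ¬p)  p = ¬p p

==-refl : {n : ℕ} (i : Fin n) → (i == i) ≡ true
==-refl i = dec-true (i Fin.≟ i) refl

==-≢ : {n : ℕ} {i j : Fin n} → i ≢ j → (i == j) ≡ false
==-≢ {i = i} {j} = dec-false (i Fin.≟ j)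

_≟ᴱ_ : {n : ℕ} → DecidableEquality (Edge n)
_≟ᴱ_ = ×.≡-dec Fin._≟_ Fin._≟_

cell : {n : ℕ} → Fin n → Fin n → List (Edge n)
cell i j = if toℕ i <ᵇ toℕ j then (i , j) ∷ [] else []

pairs′ : (n : ℕ) → List (Edge n)
pairs′ n = concatMap (λ i → concatMap (cell i) (allFin n)) (allFin n)

concatMap-≢ : {A B : Set} {f g : A → List B} → DecidableEquality B → (xs : List A) →
  concatMap f xs ≢ concatMap g xs → ∃ λ x → f x ≢ g x
concatMap-≢ _≟_ [] neq = ⊥-elim (neq refl)
concatMap-≢ {f = f} {g} _≟_ (x ∷ xs) neq with List.≡-dec _≟_ (f x) (g x)
... | no fx≢gx = x , fx≢gx
... | yes fx≡gx = concatMap-≢ _≟_ xs (λ eq → neq (cong₂ _++_ fx≡gx eq))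

-- Defs.pairs builds its cells with a local conditional that cannot be named here;
-- deciding list equality reduces the comparison with pairs′ to a single cell i j,
-- where both conditionals compute once toℕ i <ᵇ toℕ j is known.
pairs≡pairs′ : (n : ℕ) → pairs n ≡ pairs′ n
pairs≡pairs′ n with List.≡-dec _≟ᴱ_ (pairs n) (pairs′ n)
... | yes eq = eq
... | no neq with concatMap-≢ _≟ᴱ_ (allFin n) neq
... | i , row-i≢ with concatMap-≢ _≟ᴱ_ (allFin n) row-i≢
... | j , cell-ij≢ with toℕ i <ᵇ toℕ j
... | true  = ⊥-elim (cell-ij≢ refl)
... | false = ⊥-elim (cell-ij≢ refl)

module _ {n : ℕ} where

  private
    ∈-cell⁻ : {i j : Fin n} {y : Edge n} → y ∈ cell i j → y ≡ (i , j) × toℕ i < toℕ j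
    ∈-cell⁻ {i} {j} y∈cell with toℕ i <ᵇ toℕ j in lt
    ∈-cell⁻ {i} {j} (here refl) | true = refl , ℕ.<ᵇ⇒< (toℕ i) (toℕ j) (subst T (sym lt) _)

  ∈-pairs⁺ : {a b : Fin n} → toℕ a < toℕ b → (a , b) ∈ pairs n
  ∈-pairs⁺ {a} {b} a<b = subst ((a , b) ∈_) (sym (pairs≡pairs′ n))
    (∈.∈-concatMap⁺ _ (lose (∈.∈-allFin a) (∈.∈-concatMap⁺ (cell a) (lose (∈.∈-allFin b) a,b∈cell))))
    where
    a,b∈cell : (a , b) ∈ cell a b
    a,b∈cell with toℕ a <ᵇ toℕ b | ℕ.<⇒<ᵇ a<b
    ... | true | _ = here refl

  ∈-pairs⁻ : {y : Edge n} → y ∈ pairs n → toℕ (proj₁ y) < toℕ (proj₂ y)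
  ∈-pairs⁻ y∈pairs with find (∈.∈-concatMap⁻ _ {xs = allFin n} (subst (_ ∈_) (pairs≡pairs′ n) y∈pairs))
  ... | i , _ , y∈row with find (∈.∈-concatMap⁻ _ {xs = allFin n} y∈row)
  ... | j , _ , y∈cell with ∈-cell⁻ y∈cell
  ... | refl , i<j = i<j

  Unique-pairs : Unique (pairs n)
  Unique-pairs = subst Unique (sym (pairs≡pairs′ n))
    (Unique-concatMap proj₁ (Unique.allFin⁺ n) unique-row key-row)
    where
    unique-cell : ∀ i j → Unique (cell i j)
    unique-cell i j with toℕ i <ᵇ toℕ j
    ... | true  = All.[] ∷ []
    ... | false = []
    unique-row : ∀ i → Unique (concatMap (cell i) (allFin n))
    unique-row i = Unique-concatMap proj₂ (Unique.allFin⁺ n) (unique-cell i) (λ j y∈cell → cong proj₂ (proj₁ (∈-cell⁻ y∈cell)))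
    key-row : ∀ i {y} → y ∈ concatMap (cell i) (allFin n) → proj₁ y ≡ i
    key-row i y∈row with find (∈.∈-concatMap⁻ (cell i) {xs = allFin n} y∈row)
    ... | j , _ , y∈cell = cong proj₁ (proj₁ (∈-cell⁻ y∈cell))

module _ {n : ℕ} where

  open import Data.List.Membership.DecPropositional (_≟ᴱ_ {n}) using (_∈?_)

  _∈ᵇ_ : Edge n → Graph n → Bool
  x ∈ᵇ G = does (x ∈? G)

  ∈⇒∈ᵇ : {x : Edge n} {G : Graph n} → x ∈ G → T (x ∈ᵇ G)
  ∈⇒∈ᵇ {x} {G} = does-complete (x ∈? G)

  ∈ᵇ⇒∈ : {x : Edge n} {G : Graph n} → T (x ∈ᵇ G) → x ∈ G
  ∈ᵇ⇒∈ {x} {G} = does-sound (x ∈? G)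

  ∈ᵇ-filter : (p : Edge n → Bool) (xs : List (Edge n)) (x : Edge n) →
    x ∈ᵇ filterᵇ p xs ≡ (x ∈ᵇ xs) ∧ p x
  ∈ᵇ-filter p xs x with x ∈? filterᵇ p xs | x ∈? xs | p x in px
  ... | yes x∈pxs | _         | false = ⊥-elim (subst T px (proj₂ (∈.∈-filter⁻ (T? ∘ p) {xs = xs} x∈pxs)))
  ... | yes x∈pxs | no x∉xs   | true  = ⊥-elim (x∉xs (proj₁ (∈.∈-filter⁻ (T? ∘ p) {xs = xs} x∈pxs)))
  ... | yes _     | yes _     | true  = refl
  ... | no  x∉pxs | yes x∈xs  | true  = ⊥-elim (x∉pxs (∈.∈-filter⁺ (T? ∘ p) x∈xs (subst T (sym px) _)))
  ... | no  _     | yes _     | false = refl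
  ... | no  _     | no  _     | _     = refl

  edge : Fin n → Fin n → Edge n
  edge a b = if toℕ a <ᵇ toℕ b then (a , b) else (b , a)

  edge-< : {a b : Fin n} → toℕ a < toℕ b → edge a b ≡ (a , b)
  edge-< {a} {b} a<b with toℕ a <ᵇ toℕ b | ℕ.<⇒<ᵇ a<b
  ... | true | _ = refl

  edge-≮ : {a b : Fin n} → ¬ toℕ a < toℕ b → edge a b ≡ (b , a)
  edge-≮ {a} {b} a≮b with toℕ a <ᵇ toℕ b in lt
  ... | true  = ⊥-elim (a≮b (ℕ.<ᵇ⇒< (toℕ a) (toℕ b) (subst T (sym lt) _)))
  ... | false = refl

  edge-sym : (a b : Fin n) → edge a b ≡ edge b a
  edge-sym a b with ℕ.<-cmp (toℕ a) (toℕ b)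
  ... | tri< a<b _ b≮a = trans (edge-< a<b) (sym (edge-≮ b≮a))
  ... | tri≈ _ a≡b _   rewrite Fin.toℕ-injective a≡b = refl
  ... | tri> a≮b _ b<a = trans (edge-≮ a≮b) (sym (edge-< b<a))

  edge-∈-pairs : {a b : Fin n} → a ≢ b → edge a b ∈ pairs n
  edge-∈-pairs {a} {b} a≢b with ℕ.<-cmp (toℕ a) (toℕ b)
  ... | tri< a<b _ _   = subst (_∈ pairs n) (sym (edge-< a<b)) (∈-pairs⁺ a<b)
  ... | tri≈ _ a≡b _   = ⊥-elim (a≢b (Fin.toℕ-injective a≡b))
  ... | tri> a≮b _ b<a = subst (_∈ pairs n) (sym (edge-≮ a≮b)) (∈-pairs⁺ b<a)

  edge-∉-pairs : (a : Fin n) → edge a a ∉ pairs n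
  edge-∉-pairs a a,a∈pairs =
    ℕ.<-irrefl refl (subst (λ x → toℕ (proj₁ x) < toℕ (proj₂ x)) (edge-≮ {a} {a} (ℕ.<-irrefl refl)) (∈-pairs⁻ a,a∈pairs))

  edge-injective : {a b c d : Fin n} → edge a b ≡ edge c d → (a ≡ c × b ≡ d) ⊎ (a ≡ d × b ≡ c)
  edge-injective {a} {b} {c} {d} eq with toℕ a <ᵇ toℕ b | toℕ c <ᵇ toℕ d | eq
  ... | true  | true  | refl = inj₁ (refl , refl)
  ... | true  | false | refl = inj₂ (refl , refl)
  ... | false | true  | refl = inj₂ (refl , refl)
  ... | false | false | refl = inj₁ (refl , refl)

  adj : Graph n → Fin n → Fin n → Bool
  adj G a b = edge a b ∈ᵇ G

  -- The symmetric difference with {ab}, listed in the order of pairs n so that it is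
  -- again an element of allGraphs n.
  toggle : Fin n → Fin n → Graph n → Graph n
  toggle a b G = filterᵇ (λ x → (x ∈ᵇ G) xor does (x ≟ᴱ edge a b)) (pairs n)

  adj-sym : (G : Graph n) (a b : Fin n) → adj G a b ≡ adj G b a
  adj-sym G a b = cong (_∈ᵇ G) (edge-sym a b)

  adj-irrefl : {G : Graph n} → G ∈ allGraphs n → (a : Fin n) → adj G a a ≡ false
  adj-irrefl {G} G∈ a with edge a a ∈? G
  ... | yes a,a∈G = ⊥-elim (edge-∉-pairs a (subs-⊆ G∈ a,a∈G))
  ... | no  _     = refl

  adj⇒≢ : {G : Graph n} → G ∈ allGraphs n → {a b : Fin n} → adj G a b ≡ true → a ≢ b
  adj⇒≢ G∈ {a} adj-ab refl with trans (sym adj-ab) (adj-irrefl G∈ a)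
  ... | ()

  toggle-∈-allGraphs : (a b : Fin n) (G : Graph n) → toggle a b G ∈ allGraphs n
  toggle-∈-allGraphs a b G = filter-∈-subs _ (pairs n)

  toggle-sym : (a b : Fin n) (G : Graph n) → toggle a b G ≡ toggle b a G
  toggle-sym a b G = cong (λ e → filterᵇ (λ x → (x ∈ᵇ G) xor does (x ≟ᴱ e)) (pairs n)) (edge-sym a b)

  ∈ᵇ-pairs : {x : Edge n} {G : Graph n} → G ∈ allGraphs n → x ∈ᵇ G ≡ (x ∈ᵇ pairs n) ∧ (x ∈ᵇ G)
  ∈ᵇ-pairs {x} {G} G∈ with x ∈? G
  ... | yes x∈G rewrite dec-true (x ∈? pairs n) (subs-⊆ G∈ x∈G) = refl
  ... | no  _   = sym (Bool.∧-zeroʳ _)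

  toggle-involutive : {G : Graph n} → G ∈ allGraphs n → (a b : Fin n) → toggle a b (toggle a b G) ≡ G
  toggle-involutive {G} G∈ a b =
    subs-ext Unique-pairs (toggle-∈-allGraphs a b (toggle a b G)) G∈ (same-∈ᵇ⇒⊆ (sym ∘ same)) (same-∈ᵇ⇒⊆ same)
    where
    same : ∀ x → x ∈ᵇ G ≡ x ∈ᵇ toggle a b (toggle a b G)
    same x = begin
      x ∈ᵇ G                                                  ≡⟨ ∈ᵇ-pairs G∈ ⟩
      (x ∈ᵇ pairs n) ∧ (x ∈ᵇ G)                              ≡⟨ cancel (x ∈ᵇ pairs n) (x ∈ᵇ G) m ⟩
      (x ∈ᵇ pairs n) ∧ (((x ∈ᵇ pairs n) ∧ ((x ∈ᵇ G) xor m)) xor m) ≡⟨ cong (λ y → (x ∈ᵇ pairs n) ∧ (y xor m)) (∈ᵇ-filter _ (pairs n) x) ⟨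
      (x ∈ᵇ pairs n) ∧ ((x ∈ᵇ toggle a b G) xor m)           ≡⟨ ∈ᵇ-filter _ (pairs n) x ⟨
      x ∈ᵇ toggle a b (toggle a b G)                          ∎
      where
      open ≡-Reasoning
      m : Bool
      m = does (x ≟ᴱ edge a b)
      cancel : ∀ p s m → p ∧ s ≡ p ∧ ((p ∧ (s xor m)) xor m)
      cancel false _     _     = refl
      cancel true  false false = refl
      cancel true  false true  = refl
      cancel true  true  false = refl
      cancel true  true  true  = refl
    same-∈ᵇ⇒⊆ : {g h : Graph n} → (∀ x → x ∈ᵇ g ≡ x ∈ᵇ h) → g ⊆ h
    same-∈ᵇ⇒⊆ {g} {h} eq {x} x∈g = ∈ᵇ⇒∈ (subst T (eq x) (∈⇒∈ᵇ x∈g))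

  adj-toggle : (G : Graph n) {a b u v : Fin n} → u ≢ v →
    adj (toggle a b G) u v ≡ adj G u v xor does (edge u v ≟ᴱ edge a b)
  adj-toggle G {a} {b} {u} {v} u≢v =
    trans (∈ᵇ-filter _ (pairs n) (edge u v))
      (cong (_∧ (adj G u v xor does (edge u v ≟ᴱ edge a b))) (dec-true (edge u v ∈? pairs n) (edge-∈-pairs u≢v)))

  adj-toggle-self : (G : Graph n) {a b : Fin n} → a ≢ b → adj (toggle a b G) a b ≡ not (adj G a b)
  adj-toggle-self G {a} {b} a≢b = begin
    adj (toggle a b G) a b                        ≡⟨ adj-toggle G {a} {b} a≢b ⟩
    adj G a b xor does (edge a b ≟ᴱ edge a b)     ≡⟨ cong (adj G a b xor_) (dec-true (edge a b ≟ᴱ edge a b) refl) ⟩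
    adj G a b xor true                            ≡⟨ Bool.xor-comm (adj G a b) true ⟩
    not (adj G a b)                               ∎
    where open ≡-Reasoning

  adj-toggle-other : {G : Graph n} → G ∈ allGraphs n → {a b u v : Fin n} → edge u v ≢ edge a b →
    adj (toggle a b G) u v ≡ adj G u v
  adj-toggle-other {G} G∈ {a} {b} {u} {v} uv≢ab with u Fin.≟ v
  ... | yes refl = trans (adj-irrefl (toggle-∈-allGraphs a b G) u) (sym (adj-irrefl G∈ u))
  ... | no  u≢v  = begin
    adj (toggle a b G) u v                        ≡⟨ adj-toggle G {a} {b} u≢v ⟩
    adj G u v xor does (edge u v ≟ᴱ edge a b)     ≡⟨ cong (adj G u v xor_) (dec-false (edge u v ≟ᴱ edge a b) uv≢ab) ⟩
    adj G u v xor false                           ≡⟨ Bool.xor-identityʳ (adj G u v) ⟩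
    adj G u v                                     ∎
    where open ≡-Reasoning

  incident : Fin n → Edge n → Bool
  incident v x = (v == proj₁ x) ∨ (v == proj₂ x)

  other : Fin n → Edge n → Fin n
  other v x = if v == proj₁ x then proj₂ x else proj₁ x

  edge-other : {v : Fin n} {x : Edge n} → x ∈ pairs n → incident v x ≡ true → edge v (other v x) ≡ x
  edge-other {v} {p , r} x∈pairs v∈x with v Fin.≟ p | v Fin.≟ r
  ... | yes refl | _        = edge-< (∈-pairs⁻ x∈pairs)
  ... | no  _    | yes refl = edge-≮ (ℕ.<⇒≯ (∈-pairs⁻ x∈pairs))
  edge-other {v} {p , r} x∈pairs () | no _ | no _

  other-edge : {v u : Fin n} → v ≢ u → incident v (edge v u) ≡ true × other v (edge v u) ≡ u
  other-edge {v} {u} v≢u with toℕ v <ᵇ toℕ u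
  ... | true  rewrite ==-refl v = refl , refl
  ... | false rewrite ==-≢ v≢u | ==-refl v = refl , refl

  degree≡count-adj : {G : Graph n} → G ∈ allGraphs n → (v : Fin n) → degree G v ≡ count (adj G v)
  degree≡count-adj {G} G∈ v = begin
    length incidentᴳ   ≡⟨ ℕ.≤-antisym degree≤ ≤degree ⟩
    length neighbours  ≡⟨ length-filter-tabulate (adj G v) id ⟩
    count (adj G v)    ∎
    where
    open ≡-Reasoning
    incidentᴳ : List (Edge n)
    incidentᴳ = filterᵇ (incident v) G
    neighbours : List (Fin n)
    neighbours = filterᵇ (adj G v) (allFin n)

    degree≤ : length incidentᴳ ≤ length neighbours
    degree≤ = subst (length incidentᴳ ≤_) (List.length-map (edge v) neighbours)
      (length-mono-⊆ (Unique.filter⁺ (T? ∘ incident v) (Unique-∈-subs Unique-pairs G∈)) incident⊆)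
      where
      incident⊆ : incidentᴳ ⊆ map (edge v) neighbours
      incident⊆ {x} x∈ with ∈.∈-filter⁻ (T? ∘ incident v) {xs = G} x∈
      ... | x∈G , v∈x = subst (_∈ map (edge v) neighbours) x≡
        (∈.∈-map⁺ (edge v) (∈.∈-filter⁺ (T? ∘ adj G v) (∈.∈-allFin (other v x))
          (subst (T ∘ (_∈ᵇ G)) (sym x≡) (∈⇒∈ᵇ x∈G))))
        where
        x≡ : edge v (other v x) ≡ x
        x≡ = edge-other (subs-⊆ G∈ x∈G) (Equivalence.to Bool.T-≡ v∈x)

    ≤degree : length neighbours ≤ length incidentᴳ
    ≤degree = subst (length neighbours ≤_) (List.length-map (other v) incidentᴳ)
      (length-mono-⊆ (Unique.filter⁺ (T? ∘ adj G v) (Unique.allFin⁺ n)) neighbours⊆)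
      where
      neighbours⊆ : neighbours ⊆ map (other v) incidentᴳ
      neighbours⊆ {u} u∈ with ∈.∈-filter⁻ (T? ∘ adj G v) {xs = allFin n} u∈
      ... | _ , vu∈G with other-edge {v} {u} (adj⇒≢ G∈ (Equivalence.to Bool.T-≡ vu∈G))
      ... | v∈vu , other≡u = subst (_∈ map (other v) incidentᴳ) other≡u
        (∈.∈-map⁺ (other v) (∈.∈-filter⁺ (T? ∘ incident v) (∈ᵇ⇒∈ {G = G} vu∈G) (Equivalence.from Bool.T-≡ v∈vu)))

  nonNeighbour : Graph n → Fin n → Fin n → Bool
  nonNeighbour G v = (not ∘ adj G v) ∖ v

  degree+nonNeighbours : {G : Graph n} → G ∈ allGraphs n → (v : Fin n) →
    suc (degree G v + count (nonNeighbour G v)) ≡ n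
  degree+nonNeighbours {G} G∈ v = begin
    suc (degree G v + count (nonNeighbour G v))          ≡⟨ ℕ.+-suc (degree G v) _ ⟨
    degree G v + suc (count (nonNeighbour G v))          ≡⟨ cong (λ b → degree G v + (bit (not b) + count (nonNeighbour G v))) (adj-irrefl G∈ v) ⟨
    degree G v + (bit (not (adj G v v)) + count (nonNeighbour G v)) ≡⟨ cong₂ _+_ (degree≡count-adj G∈ v) (sym (count-split (not ∘ adj G v) v)) ⟩
    count (adj G v) + count (not ∘ adj G v)              ≡⟨ count-complement (adj G v) ⟩
    n                                                    ∎
    where open ≡-Reasoning

  degree<n : {G : Graph n} → G ∈ allGraphs n → (v : Fin n) → degree G v < n
  degree<n G∈ v = ℕ.≤-trans (s≤s (ℕ.m≤m+n _ _)) (ℕ.≤-reflexive (degree+nonNeighbours G∈ v))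

  nonNeighbour-exists : {G : Graph n} → G ∈ allGraphs n → (v : Fin n) → degree G v + 2 ≤ n →
    ∃ λ u → u ≢ v × adj G v u ≡ false
  nonNeighbour-exists {G} G∈ v deg+2≤n with count-witness (nonNeighbour G v) 1≤count
    where
    1≤count : 1 ≤ count (nonNeighbour G v)
    1≤count = ℕ.+-cancelˡ-≤ (suc (degree G v)) 1 _
      (subst₂ _≤_ (ℕ.+-suc (degree G v) 1) (sym (degree+nonNeighbours G∈ v)) deg+2≤n)
  ... | u , u-nonNbr with adj G v u in vu | u Fin.≟ v | u-nonNbr
  ...   | false | no u≢v | _  = u , u≢v , vu
  ...   | false | yes _  | ()
  ...   | true  | _      | ()

  nonNeighbour⇒degree+2≤n : {G : Graph n} → G ∈ allGraphs n → {v u : Fin n} → u ≢ v → adj G v u ≡ false →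
    degree G v + 2 ≤ n
  nonNeighbour⇒degree+2≤n {G} G∈ {v} {u} u≢v vu∉G = begin
    degree G v + 2                               ≡⟨ ℕ.+-suc (degree G v) 1 ⟩
    suc (degree G v + 1)                         ≤⟨ s≤s (ℕ.+-monoʳ-≤ (degree G v) (count-positive u u-nonNbr)) ⟩
    suc (degree G v + count (nonNeighbour G v))  ≡⟨ degree+nonNeighbours G∈ v ⟩
    n                                            ∎
    where
    open ℕ.≤-Reasoning
    u-nonNbr : nonNeighbour G v u ≡ true
    u-nonNbr rewrite vu∉G | ==-≢ u≢v = refl

  neighbour-exists : {G : Graph n} → G ∈ allGraphs n → (v : Fin n) → 1 ≤ degree G v →
    ∃ λ u → adj G v u ≡ true
  neighbour-exists {G} G∈ v 1≤deg = count-witness (adj G v) (subst (1 ≤_) (degree≡count-adj G∈ v) 1≤deg)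

  neighbour⇒1≤degree : {G : Graph n} → G ∈ allGraphs n → {v u : Fin n} → adj G v u ≡ true → 1 ≤ degree G v
  neighbour⇒1≤degree G∈ {v} {u} vu∈G = subst (1 ≤_) (sym (degree≡count-adj G∈ v)) (count-positive u vu∈G)

  degree-mono : {G G′ : Graph n} → G ∈ allGraphs n → G′ ∈ allGraphs n → (v : Fin n) →
    (∀ u → adj G v u ≡ true → adj G′ v u ≡ true) → degree G v ≤ degree G′ v
  degree-mono {G} {G′} G∈ G′∈ v G⊆G′ =
    subst₂ _≤_ (sym (degree≡count-adj G∈ v)) (sym (degree≡count-adj G′∈ v)) (count-mono G⊆G′)

  degree-toggle-endpoint : {G : Graph n} → G ∈ allGraphs n → {a b : Fin n} → a ≢ b → adj G a b ≡ false →
    degree (toggle a b G) a ≡ degree G a + 1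
  degree-toggle-endpoint {G} G∈ {a} {b} a≢b ab∉G = begin
    degree (toggle a b G) a                           ≡⟨ degree≡count-adj (toggle-∈-allGraphs a b G) a ⟩
    count (adj (toggle a b G) a)                      ≡⟨ count-split _ b ⟩
    bit (adj (toggle a b G) a b) + count (adj (toggle a b G) a ∖ b)
      ≡⟨ cong₂ (λ x y → bit x + y) (trans (adj-toggle-self G a≢b) (cong not ab∉G)) (count-cong same-off-b) ⟩
    1 + count (adj G a ∖ b)                           ≡⟨ ℕ.+-comm 1 _ ⟩
    count (adj G a ∖ b) + 1                           ≡⟨ cong (λ x → bit x + count (adj G a ∖ b) + 1) ab∉G ⟨
    bit (adj G a b) + count (adj G a ∖ b) + 1         ≡⟨ cong (_+ 1) (count-split (adj G a) b) ⟨
    count (adj G a) + 1                               ≡⟨ cong (_+ 1) (degree≡count-adj G∈ a) ⟨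
    degree G a + 1                                    ∎
    where
    open ≡-Reasoning
    same-off-b : ∀ u → (adj (toggle a b G) a ∖ b) u ≡ (adj G a ∖ b) u
    same-off-b u with u Fin.≟ b
    ... | yes refl = trans (Bool.∧-zeroʳ _) (sym (Bool.∧-zeroʳ _))
    ... | no  u≢b  = cong (_∧ true) (adj-toggle-other G∈ au≢ab)
      where
      au≢ab : edge a u ≢ edge a b
      au≢ab eq with edge-injective eq
      ... | inj₁ (_ , u≡b)   = u≢b u≡b
      ... | inj₂ (a≡b , _)   = a≢b a≡b

  degree-toggle-other : {G : Graph n} → G ∈ allGraphs n → {a b k : Fin n} → k ≢ a → k ≢ b →
    degree (toggle a b G) k ≡ degree G k
  degree-toggle-other {G} G∈ {a} {b} {k} k≢a k≢b = begin
    degree (toggle a b G) k          ≡⟨ degree≡count-adj (toggle-∈-allGraphs a b G) k ⟩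
    count (adj (toggle a b G) k)     ≡⟨ count-cong (λ u → adj-toggle-other G∈ (ku≢ab u)) ⟩
    count (adj G k)                  ≡⟨ degree≡count-adj G∈ k ⟨
    degree G k                       ∎
    where
    open ≡-Reasoning
    ku≢ab : ∀ u → edge k u ≢ edge a b
    ku≢ab u eq with edge-injective eq
    ... | inj₁ (k≡a , _) = k≢a k≡a
    ... | inj₂ (k≡b , _) = k≢b k≡b

-- Degree sequences and the families 𝒟

module _ {n : ℕ} where

  infixl 6 _⊕_ _⊖_

  unit : Fin n → Seq n
  unit i = ind i (+ 1)

  _⊕_ _⊖_ : Seq n → Fin n → Seq n
  (E ⊕ i) k = E k ℤ.+ unit i k
  (E ⊖ i) k = E k ℤ.- unit i k

  degrees : Graph n → Seq n
  degrees G k = + degree G k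

  unit-self : (i : Fin n) → unit i i ≡ + 1
  unit-self i rewrite ==-refl i = refl

  unit-other : {i k : Fin n} → i ≢ k → unit i k ≡ + 0
  unit-other i≢k rewrite ==-≢ i≢k = refl

  ind-minus : (i k : Fin n) → ind i minus1 k ≡ ℤ.- unit i k
  ind-minus i k with i == k
  ... | true  = refl
  ... | false = refl

  ⊕-self : (E : Seq n) (i : Fin n) → (E ⊕ i) i ≡ E i ℤ.+ + 1
  ⊕-self E i = cong (λ x → E i ℤ.+ x) (unit-self i)

  ⊖-self : (E : Seq n) (i : Fin n) → (E ⊖ i) i ≡ E i ℤ.- + 1
  ⊖-self E i = cong (λ x → E i ℤ.- x) (unit-self i)

  ⊕-other : (E : Seq n) {i k : Fin n} → i ≢ k → (E ⊕ i) k ≡ E k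
  ⊕-other E {k = k} i≢k = trans (cong (λ x → E k ℤ.+ x) (unit-other i≢k)) (ℤ.+-identityʳ (E k))

  ⊖-other : (E : Seq n) {i k : Fin n} → i ≢ k → (E ⊖ i) k ≡ E k
  ⊖-other E {k = k} i≢k = trans (cong (λ x → E k ℤ.- x) (unit-other i≢k)) (ℤ.+-identityʳ (E k))

  degree-plus : {G : Graph n} {E : Seq n} → degrees G ≗ E → {k : Fin n} {d : ℕ} → E k ≡ + d → degree G k ≡ d
  degree-plus G≗E {k} Ek≡d = ℤ.+-injective (trans (G≗E k) Ek≡d)

  degree-minus : {G : Graph n} {E : Seq n} → degrees G ≗ E → {k : Fin n} {d c : ℕ} → E k ≡ + d ℤ.- + c →
    degree G k + c ≡ d
  degree-minus {G} G≗E {k} {d} {c} Ek≡d-c = ℤ.+-injective (begin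
    + degree G k ℤ.+ + c       ≡⟨ cong (ℤ._+ + c) (trans (G≗E k) Ek≡d-c) ⟩
    + d ℤ.- + c ℤ.+ + c        ≡⟨ cancel (+ d) (+ c) ⟩
    + d                        ∎)
    where
    open ≡-Reasoning
    cancel : ∀ x y → x ℤ.- y ℤ.+ y ≡ x
    cancel = solve-∀

  degrees-add-edge : {G : Graph n} → G ∈ allGraphs n → {a b : Fin n} → a ≢ b → adj G a b ≡ false →
    {E : Seq n} → degrees G ≗ E → degrees (toggle a b G) ≗ E ⊕ a ⊕ b
  degrees-add-edge {G} G∈ {a} {b} a≢b ab∉G {E} G≗E k with k Fin.≟ a | k Fin.≟ b
  ... | yes refl | _ = begin
    + degree (toggle a b G) a   ≡⟨ cong +_ (degree-toggle-endpoint G∈ a≢b ab∉G) ⟩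
    degrees G a ℤ.+ + 1         ≡⟨ cong (ℤ._+ + 1) (G≗E a) ⟩
    E a ℤ.+ + 1                 ≡⟨ ⊕-self E a ⟨
    (E ⊕ a) a                   ≡⟨ ⊕-other (E ⊕ a) (a≢b ∘ sym) ⟨
    (E ⊕ a ⊕ b) a               ∎
    where open ≡-Reasoning
  ... | no k≢a | yes refl = begin
    + degree (toggle a b G) b   ≡⟨ cong (λ H → + degree H b) (toggle-sym a b G) ⟩
    + degree (toggle b a G) b   ≡⟨ cong +_ (degree-toggle-endpoint G∈ (a≢b ∘ sym) (trans (adj-sym G b a) ab∉G)) ⟩
    degrees G b ℤ.+ + 1         ≡⟨ cong (ℤ._+ + 1) (trans (G≗E b) (sym (⊕-other E a≢b))) ⟩
    (E ⊕ a) b ℤ.+ + 1           ≡⟨ ⊕-self (E ⊕ a) b ⟨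
    (E ⊕ a ⊕ b) b               ∎
    where open ≡-Reasoning
  ... | no k≢a | no k≢b = begin
    + degree (toggle a b G) k   ≡⟨ cong +_ (degree-toggle-other G∈ k≢a k≢b) ⟩
    degrees G k                 ≡⟨ G≗E k ⟩
    E k                         ≡⟨ ⊕-other E (k≢a ∘ sym) ⟨
    (E ⊕ a) k                   ≡⟨ ⊕-other (E ⊕ a) (k≢b ∘ sym) ⟨
    (E ⊕ a ⊕ b) k               ∎
    where open ≡-Reasoning

  degrees-remove-edge : {G : Graph n} → G ∈ allGraphs n → {a b : Fin n} → adj G a b ≡ true →
    {E : Seq n} → degrees G ≗ E → degrees (toggle a b G) ≗ E ⊖ a ⊖ b
  degrees-remove-edge {G} G∈ {a} {b} ab∈G {E} G≗E k = begin
    degrees H k                               ≡⟨ add-back k ⟩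
    degrees G k ℤ.- unit a k ℤ.- unit b k     ≡⟨ cong (λ x → x ℤ.- unit a k ℤ.- unit b k) (G≗E k) ⟩
    (E ⊖ a ⊖ b) k                             ∎
    where
    open ≡-Reasoning
    H : Graph n
    H = toggle a b G
    a≢b : a ≢ b
    a≢b = adj⇒≢ G∈ ab∈G
    G≗H⊕a⊕b : degrees G ≗ degrees H ⊕ a ⊕ b
    G≗H⊕a⊕b = subst (λ G′ → degrees G′ ≗ degrees H ⊕ a ⊕ b) (toggle-involutive G∈ a b)
      (degrees-add-edge (toggle-∈-allGraphs a b G) a≢b (trans (adj-toggle-self G a≢b) (cong not ab∈G)) (λ _ → refl))
    add-back : ∀ k → degrees H k ≡ degrees G k ℤ.- unit a k ℤ.- unit b k
    add-back k = trans (cancel (degrees H k) (unit a k) (unit b k)) (cong (λ x → x ℤ.- unit a k ℤ.- unit b k) (sym (G≗H⊕a⊕b k)))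
      where
      cancel : ∀ h x y → h ≡ h ℤ.+ x ℤ.+ y ℤ.- x ℤ.- y
      cancel = solve-∀

module _ {n : ℕ} where

  seqEq⇒≗ : {E F : Seq n} → T (seqEq E F) → E ≗ F
  seqEq⇒≗ {E} {F} eq k = does-sound (E k ℤ.≟ F k) (All.lookup (All.all⁺ _ (allFin n) eq) (∈.∈-allFin k))

  ≗⇒seqEq : {E F : Seq n} → E ≗ F → T (seqEq E F)
  ≗⇒seqEq {E} {F} E≗F = All.all⁻ _ {xs = allFin n} (All.tabulate (λ {k} _ → does-complete (E k ℤ.≟ F k) (E≗F k)))

  hasDegrees⁺ : {G : Graph n} {E : Seq n} → degrees G ≗ E → T (hasDegrees G E)
  hasDegrees⁺ = ≗⇒seqEq

  hasDegrees⁻ : {G : Graph n} {E : Seq n} → T (hasDegrees G E) → degrees G ≗ E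
  hasDegrees⁻ = seqEq⇒≗

  offDiagFamily⁻ : {D E : Seq n} {a b : ℤ} → T (offDiagFamily D a b E) →
    ∃₂ λ i j → i ≢ j × E ≗ perturb D a i b j
  offDiagFamily⁻ E∈ with find (Any.any⁻ _ (allFin n) E∈)
  ... | i , _ , E∈ᵢ with find (Any.any⁻ _ (allFin n) E∈ᵢ)
  ... | j , _ , E∈ᵢⱼ with i Fin.≟ j
  ... | no i≢j = i , j , i≢j , seqEq⇒≗ E∈ᵢⱼ

  offDiagFamily⁺ : {D E : Seq n} {a b : ℤ} {i j : Fin n} → i ≢ j → E ≗ perturb D a i b j →
    T (offDiagFamily D a b E)
  offDiagFamily⁺ {D} {E} {a} {b} {i} {j} i≢j E≗ =
    Any.any⁺ _ (lose (∈.∈-allFin i) (Any.any⁺ _ (lose (∈.∈-allFin j)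
      (subst (λ c → T (not c ∧ seqEq E (perturb D a i b j))) (sym (==-≢ i≢j)) (≗⇒seqEq E≗)))))

  diagFamily⁻ : {D E : Seq n} {a : ℤ} → T (diagFamily D a E) → ∃ λ i → E ≗ perturb D a i a i
  diagFamily⁻ E∈ with find (Any.any⁻ _ (allFin n) E∈)
  ... | i , _ , E∈ᵢ = i , seqEq⇒≗ E∈ᵢ

module Families {n : ℕ} (D : Seq n) {E : Seq n} where

  private
    minus-minus : (i j : Fin n) → perturb D minus1 i minus1 j ≗ D ⊖ i ⊖ j
    minus-minus i j k = cong₂ (λ x y → D k ℤ.+ x ℤ.+ y) (ind-minus i k) (ind-minus j k)

    plus-minus : (i j : Fin n) → perturb D plus1 i minus1 j ≗ D ⊕ i ⊖ j
    plus-minus i j k = cong (λ y → (D ⊕ i) k ℤ.+ y) (ind-minus j k)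

  𝒟pp⁻ : T (𝒟pp D E) → ∃₂ λ i j → i ≢ j × E ≗ D ⊕ i ⊕ j
  𝒟pp⁻ = offDiagFamily⁻ {D = D} {E} {plus1} {plus1}

  𝒟pp⁺ : {i j : Fin n} → i ≢ j → E ≗ D ⊕ i ⊕ j → T (𝒟pp D E)
  𝒟pp⁺ = offDiagFamily⁺ {D = D} {E} {plus1} {plus1}

  𝒟mm⁻ : T (𝒟mm D E) → ∃₂ λ i j → i ≢ j × E ≗ D ⊖ i ⊖ j
  𝒟mm⁻ E∈ with offDiagFamily⁻ {D = D} {E} {minus1} {minus1} E∈
  ... | i , j , i≢j , E≗ = i , j , i≢j , λ k → trans (E≗ k) (minus-minus i j k)

  𝒟mm⁺ : {i j : Fin n} → i ≢ j → E ≗ D ⊖ i ⊖ j → T (𝒟mm D E)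
  𝒟mm⁺ {i} {j} i≢j E≗ = offDiagFamily⁺ {D = D} {E} {minus1} {minus1} i≢j (λ k → trans (E≗ k) (sym (minus-minus i j k)))

  𝒟pm⁻ : T (𝒟pm D E) → ∃₂ λ i j → i ≢ j × E ≗ D ⊕ i ⊖ j
  𝒟pm⁻ E∈ with offDiagFamily⁻ {D = D} {E} {plus1} {minus1} E∈
  ... | i , j , i≢j , E≗ = i , j , i≢j , λ k → trans (E≗ k) (plus-minus i j k)

  𝒟pm⁺ : {i j : Fin n} → i ≢ j → E ≗ D ⊕ i ⊖ j → T (𝒟pm D E)
  𝒟pm⁺ {i} {j} i≢j E≗ = offDiagFamily⁺ {D = D} {E} {plus1} {minus1} i≢j (λ k → trans (E≗ k) (sym (plus-minus i j k)))

  𝒟p2⁻ : T (𝒟p2 D E) → ∃ λ i → E ≗ D ⊕ i ⊕ i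
  𝒟p2⁻ = diagFamily⁻ {D = D} {E} {plus1}

  𝒟m2⁻ : T (𝒟m2 D E) → ∃ λ i → E ≗ D ⊖ i ⊖ i
  𝒟m2⁻ E∈ with diagFamily⁻ {D = D} {E} {minus1} E∈
  ... | i , E≗ = i , λ k → trans (E≗ k) (minus-minus i i k)

-- Toggling edges and paths

module _ {n : ℕ} where

  allPairs : List (Fin n × Fin n)
  allPairs = cartesianProduct (allFin n) (allFin n)

  toggles : List (Graph n → Graph n)
  toggles = map (λ (a , b) → toggle a b) allPairs

  togglePath : Fin n → Fin n → Fin n → Fin n → Graph n → Graph n
  togglePath a b c d = toggle a b ∘ toggle c d ∘ toggle b c

  pathToggles : List (Graph n → Graph n)
  pathToggles = map (λ ((a , b) , (c , d)) → togglePath a b c d) (cartesianProduct allPairs allPairs)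

  ∈-allPairs : (a b : Fin n) → (a , b) ∈ allPairs
  ∈-allPairs a b = ∈.∈-cartesianProduct⁺ (∈.∈-allFin a) (∈.∈-allFin b)

  toggle-∈-toggles : (a b : Fin n) → toggle a b ∈ toggles
  toggle-∈-toggles a b = ∈.∈-map⁺ _ (∈-allPairs a b)

  togglePath-∈-pathToggles : (a b c d : Fin n) → togglePath a b c d ∈ pathToggles
  togglePath-∈-pathToggles a b c d = ∈.∈-map⁺ _ (∈.∈-cartesianProduct⁺ (∈-allPairs a b) (∈-allPairs c d))

  length-allPairs : length allPairs ≡ n * n
  length-allPairs = trans (length-cartesianProductWith _,_ (allFin n) (allFin n))
    (cong₂ _*_ (List.length-tabulate {n = n} id) (List.length-tabulate {n = n} id))

  square : n * n ≡ n ^ 2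
  square = cong (n *_) (sym (ℕ.*-identityʳ n))

  length-toggles : length toggles ≡ n ^ 2
  length-toggles = begin
    length toggles  ≡⟨ List.length-map _ allPairs ⟩
    length allPairs ≡⟨ length-allPairs ⟩
    n * n           ≡⟨ square ⟩
    n ^ 2           ∎
    where open ≡-Reasoning

  pathAndEdgeToggles : List (Graph n → Graph n)
  pathAndEdgeToggles = pathToggles ++ toggles

  length-pathAndEdgeToggles : length pathAndEdgeToggles ≡ n ^ 4 + n ^ 2
  length-pathAndEdgeToggles = begin
    length (pathToggles ++ toggles)           ≡⟨ List.length-++ pathToggles ⟩
    length pathToggles + length toggles       ≡⟨ cong₂ _+_ (List.length-map _ (cartesianProduct allPairs allPairs)) length-toggles ⟩
    length (cartesianProduct allPairs allPairs) + n ^ 2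
      ≡⟨ cong (_+ n ^ 2) (trans (length-cartesianProductWith _,_ allPairs allPairs) (cong₂ _*_ length-allPairs length-allPairs)) ⟩
    n * n * (n * n) + n ^ 2                   ≡⟨ cong (_+ n ^ 2) (ℕ.*-assoc n n (n * n)) ⟩
    n * (n * (n * n)) + n ^ 2                 ≡⟨ cong (λ x → n * (n * x) + n ^ 2) square ⟩
    n ^ 4 + n ^ 2                             ∎
    where open ≡-Reasoning

  Covered𝒢 : List (Graph n → Graph n) → (Graph n → Bool) → Graph n → Set
  Covered𝒢 = Covered (allGraphs n)

  covered-by-toggle : {moves : List (Graph n → Graph n)} {Q : Graph n → Bool} {G : Graph n} (a b : Fin n) →
    toggle a b ∈ moves → G ∈ allGraphs n → T (Q (toggle a b G)) → Covered𝒢 moves Q G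
  covered-by-toggle {G = G} a b ∈moves G∈ QH =
    toggle a b , toggle a b G , ∈moves , toggle-∈-allGraphs a b G , QH , toggle-involutive G∈ a b

  covered-by-path : {moves : List (Graph n → Graph n)} {Q : Graph n → Bool} {G : Graph n} (a b c d : Fin n) →
    togglePath a b c d ∈ moves → G ∈ allGraphs n → T (Q (toggle b c (toggle c d (toggle a b G)))) → Covered𝒢 moves Q G
  covered-by-path {G = G} a b c d ∈moves G∈ QH =
    togglePath a b c d , H , ∈moves , toggle-∈-allGraphs b c G₂ , QH , undo
    where
    G₁ G₂ H : Graph n
    G₁ = toggle a b G
    G₂ = toggle c d G₁
    H = toggle b c G₂
    undo : togglePath a b c d H ≡ G
    undo = begin
      toggle a b (toggle c d (toggle b c H)) ≡⟨ cong (toggle a b ∘ toggle c d) (toggle-involutive (toggle-∈-allGraphs c d G₁) b c) ⟩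
      toggle a b (toggle c d G₂)             ≡⟨ cong (toggle a b) (toggle-involutive (toggle-∈-allGraphs a b G) c d) ⟩
      toggle a b G₁                          ≡⟨ toggle-involutive G∈ a b ⟩
      G                                      ∎
      where open ≡-Reasoning

-- Covering the perturbed families

module Covering {n : ℕ} (D : Fin n → ℕ) {G₀ : Graph n} (G₀∈ : G₀ ∈ allGraphs n) (G₀≗D : degrees G₀ ≗ toSeq D) where

  private
    Dˢ : Seq n
    Dˢ = toSeq D

  open Families Dˢ

  D<n : ∀ v → D v < n
  D<n v = subst (_< n) (ℤ.+-injective (G₀≗D v)) (degree<n G₀∈ v)

  degree-⊕⊕ : {G : Graph n} {i : Fin n} → degrees G ≗ Dˢ ⊕ i ⊕ i → degree G i ≡ D i + 1 + 1
  degree-⊕⊕ {G} {i} G≗ = degree-plus {G = G} G≗ (trans (⊕-self (Dˢ ⊕ i) i) (cong (ℤ._+ + 1) (⊕-self Dˢ i)))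

  degree-⊖⊖ : {G : Graph n} {i : Fin n} → degrees G ≗ Dˢ ⊖ i ⊖ i → degree G i + 2 ≡ D i
  degree-⊖⊖ {G} {i} G≗ = degree-minus {G = G} G≗
    (trans (⊖-self (Dˢ ⊖ i) i) (trans (cong (ℤ._- + 1) (⊖-self Dˢ i)) (ℤ.+-assoc (+ D i) (ℤ.- + 1) (ℤ.- + 1))))

  degree-⊕⊕-other : {G : Graph n} {i v : Fin n} → degrees G ≗ Dˢ ⊕ i ⊕ i → i ≢ v → degree G v ≡ D v
  degree-⊕⊕-other {G} {i} G≗ i≢v = degree-plus {G = G} G≗ (trans (⊕-other (Dˢ ⊕ i) i≢v) (⊕-other Dˢ i≢v))

  degree-⊖⊖-other : {G : Graph n} {i v : Fin n} → degrees G ≗ Dˢ ⊖ i ⊖ i → i ≢ v → degree G v ≡ D v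
  degree-⊖⊖-other {G} {i} G≗ i≢v = degree-plus {G = G} G≗ (trans (⊖-other (Dˢ ⊖ i) i≢v) (⊖-other Dˢ i≢v))

  in𝒟pm∪D in𝒟pm in𝒟pp in𝒟mm : Graph n → Bool
  in𝒟pm∪D H = 𝒟pm Dˢ (degrees H) ∨ hasDegrees H Dˢ
  in𝒟pm H = 𝒟pm Dˢ (degrees H)
  in𝒟pp H = 𝒟pp Dˢ (degrees H)
  in𝒟mm H = 𝒟mm Dˢ (degrees H)

  pp-covered : {G : Graph n} → G ∈ allGraphs n → T (𝒟pp Dˢ (degrees G)) → Covered𝒢 toggles in𝒟pm∪D G
  pp-covered {G} G∈ G∈pp with 𝒟pp⁻ {E = degrees G} G∈pp
  ... | i , j , i≢j , G≗ with neighbour-exists G∈ i (subst (1 ≤_) (sym deg-i) (ℕ.m≤n+m 1 (D i)))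
    where
    deg-i : degree G i ≡ D i + 1
    deg-i = degree-plus {G = G} G≗ (trans (⊕-other (Dˢ ⊕ i) (i≢j ∘ sym)) (⊕-self Dˢ i))
  ... | u , iu∈G with u Fin.≟ j
  ...   | yes refl = covered-by-toggle i j (toggle-∈-toggles i j) G∈
    (Equivalence.from Bool.T-∨ (inj₂ (hasDegrees⁺ {G = toggle i j G} H≗)))
    where
    H≗ : degrees (toggle i j G) ≗ Dˢ
    H≗ k = trans (degrees-remove-edge G∈ iu∈G G≗ k) (cancel (Dˢ k) (unit i k) (unit j k))
      where
      cancel : ∀ d a b → d ℤ.+ a ℤ.+ b ℤ.- a ℤ.- b ≡ d
      cancel = solve-∀
  ...   | no u≢j = covered-by-toggle i u (toggle-∈-toggles i u) G∈
    (Equivalence.from Bool.T-∨ (inj₁ (𝒟pm⁺ {E = degrees (toggle i u G)} (u≢j ∘ sym) H≗)))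
    where
    H≗ : degrees (toggle i u G) ≗ Dˢ ⊕ j ⊖ u
    H≗ k = trans (degrees-remove-edge G∈ iu∈G G≗ k) (cancel (Dˢ k) (unit i k) (unit j k) (unit u k))
      where
      cancel : ∀ d a b c → d ℤ.+ a ℤ.+ b ℤ.- a ℤ.- c ≡ d ℤ.+ b ℤ.- c
      cancel = solve-∀

  mm-covered : {G : Graph n} → G ∈ allGraphs n → T (𝒟mm Dˢ (degrees G)) → Covered𝒢 toggles in𝒟pm∪D G
  mm-covered {G} G∈ G∈mm with 𝒟mm⁻ {E = degrees G} G∈mm
  ... | i , j , i≢j , G≗ with nonNeighbour-exists G∈ i (subst (_≤ n) (trans (cong suc (sym deg-i)) (sym (ℕ.+-suc _ 1))) (D<n i))
    where
    deg-i : degree G i + 1 ≡ D i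
    deg-i = degree-minus {G = G} G≗ (trans (⊖-other (Dˢ ⊖ i) (i≢j ∘ sym)) (⊖-self Dˢ i))
  ... | u , u≢i , iu∉G with u Fin.≟ j
  ...   | yes refl = covered-by-toggle i j (toggle-∈-toggles i j) G∈
    (Equivalence.from Bool.T-∨ (inj₂ (hasDegrees⁺ {G = toggle i j G} H≗)))
    where
    H≗ : degrees (toggle i j G) ≗ Dˢ
    H≗ k = trans (degrees-add-edge G∈ (u≢i ∘ sym) iu∉G G≗ k) (cancel (Dˢ k) (unit i k) (unit j k))
      where
      cancel : ∀ d a b → d ℤ.- a ℤ.- b ℤ.+ a ℤ.+ b ≡ d
      cancel = solve-∀
  ...   | no u≢j = covered-by-toggle i u (toggle-∈-toggles i u) G∈
    (Equivalence.from Bool.T-∨ (inj₁ (𝒟pm⁺ {E = degrees (toggle i u G)} u≢j H≗)))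
    where
    H≗ : degrees (toggle i u G) ≗ Dˢ ⊕ u ⊖ j
    H≗ k = trans (degrees-add-edge G∈ (u≢i ∘ sym) iu∉G G≗ k) (cancel (Dˢ k) (unit i k) (unit j k) (unit u k))
      where
      cancel : ∀ d a b c → d ℤ.- a ℤ.- b ℤ.+ a ℤ.+ c ≡ d ℤ.+ c ℤ.- b
      cancel = solve-∀

  p2-covered : {G : Graph n} → G ∈ allGraphs n → T (𝒟p2 Dˢ (degrees G)) → Covered𝒢 toggles in𝒟pm G
  p2-covered {G} G∈ G∈p2 with 𝒟p2⁻ {E = degrees G} G∈p2
  ... | i , G≗ with neighbour-exists G∈ i (subst (1 ≤_) (sym (degree-⊕⊕ {G = G} G≗)) (ℕ.m≤n+m 1 (D i + 1)))
  ... | u , iu∈G = covered-by-toggle i u (toggle-∈-toggles i u) G∈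
    (𝒟pm⁺ {E = degrees (toggle i u G)} (adj⇒≢ G∈ iu∈G) H≗)
    where
    H≗ : degrees (toggle i u G) ≗ Dˢ ⊕ i ⊖ u
    H≗ k = trans (degrees-remove-edge G∈ iu∈G G≗ k) (cancel (Dˢ k) (unit i k) (unit u k))
      where
      cancel : ∀ d a b → d ℤ.+ a ℤ.+ a ℤ.- a ℤ.- b ≡ d ℤ.+ a ℤ.- b
      cancel = solve-∀

  m2-covered : {G : Graph n} → G ∈ allGraphs n → T (𝒟m2 Dˢ (degrees G)) → Covered𝒢 toggles in𝒟pm G
  m2-covered {G} G∈ G∈m2 with 𝒟m2⁻ {E = degrees G} G∈m2
  ... | i , G≗ with nonNeighbour-exists G∈ i
        (ℕ.≤-trans (ℕ.m≤m+n _ 1) (subst (_≤ n) (trans (cong suc (sym (degree-⊖⊖ {G = G} G≗))) (ℕ.+-comm 1 _)) (D<n i)))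
  ... | u , u≢i , iu∉G = covered-by-toggle i u (toggle-∈-toggles i u) G∈
    (𝒟pm⁺ {E = degrees (toggle i u G)} u≢i H≗)
    where
    H≗ : degrees (toggle i u G) ≗ Dˢ ⊕ u ⊖ i
    H≗ k = trans (degrees-add-edge G∈ (u≢i ∘ sym) iu∉G G≗ k) (cancel (Dˢ k) (unit i k) (unit u k))
      where
      cancel : ∀ d a b → d ℤ.- a ℤ.- a ℤ.+ a ℤ.+ b ≡ d ℤ.+ b ℤ.- a
      cancel = solve-∀

  -- If every neighbour w of i were adjacent to all other vertices, the neighbours of i
  -- in G would also be neighbours of i in the realisation G₀ of D, contradicting
  -- deg_G i = d_i + 2 > d_i = deg_G₀ i.
  ⊕⊕-neighbour-of-low-degree : {G : Graph n} → G ∈ allGraphs n → {i : Fin n} → degrees G ≗ Dˢ ⊕ i ⊕ i →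
    ∃ λ w → adj G i w ≡ true × degree G w + 2 ≤ n
  ⊕⊕-neighbour-of-low-degree {G} G∈ {i} G≗ with Fin.any? (λ w → (adj G i w Bool.≟ true) ×-dec (degree G w + 2 ℕ.≤? n))
  ... | yes found = found
  ... | no  none  = ⊥-elim (ℕ.m+1+n≰m (D i) (begin
    D i + 2             ≡⟨ ℕ.+-assoc (D i) 1 1 ⟨
    D i + 1 + 1         ≡⟨ degree-⊕⊕ {G = G} G≗ ⟨
    degree G i          ≤⟨ degree-mono G∈ G₀∈ i neighbours⊆ ⟩
    degree G₀ i         ≡⟨ ℤ.+-injective (G₀≗D i) ⟩
    D i                 ∎))
    where
    open ℕ.≤-Reasoning
    neighbours⊆ : ∀ u → adj G i u ≡ true → adj G₀ i u ≡ true
    neighbours⊆ u iu∈G with adj G₀ i u in iu∈G₀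
    ... | true  = refl
    ... | false = ⊥-elim (none (u , iu∈G , subst (λ d → d + 2 ≤ n) (sym deg-u) D-u+2≤n))
      where
      i≢u : i ≢ u
      i≢u = adj⇒≢ G∈ iu∈G
      deg-u : degree G u ≡ D u
      deg-u = degree-⊕⊕-other {G = G} G≗ i≢u
      D-u+2≤n : D u + 2 ≤ n
      D-u+2≤n = subst (λ d → d + 2 ≤ n) (ℤ.+-injective (G₀≗D u))
        (nonNeighbour⇒degree+2≤n G₀∈ i≢u (trans (adj-sym G₀ u i) iu∈G₀))

  -- Dually, if every non-neighbour w ≠ j of j were isolated, the neighbours of j in G₀
  -- would stay neighbours of j in G, contradicting deg_G j = d_j − 2 < d_j = deg_G₀ j.
  ⊖⊖-non-neighbour-of-positive-degree : {G : Graph n} → G ∈ allGraphs n → {j : Fin n} → degrees G ≗ Dˢ ⊖ j ⊖ j →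
    ∃ λ w → w ≢ j × adj G j w ≡ false × 1 ≤ degree G w
  ⊖⊖-non-neighbour-of-positive-degree {G} G∈ {j} G≗
    with Fin.any? (λ w → ¬? (w Fin.≟ j) ×-dec (adj G j w Bool.≟ false) ×-dec (1 ℕ.≤? degree G w))
  ... | yes found = found
  ... | no  none  = ⊥-elim (ℕ.m+1+n≰m (degree G j) (begin
    degree G j + 2      ≡⟨ degree-⊖⊖ {G = G} G≗ ⟩
    D j                 ≡⟨ ℤ.+-injective (G₀≗D j) ⟨
    degree G₀ j         ≤⟨ degree-mono G₀∈ G∈ j neighbours⊆ ⟩
    degree G j          ∎))
    where
    open ℕ.≤-Reasoning
    neighbours⊆ : ∀ v → adj G₀ j v ≡ true → adj G j v ≡ true
    neighbours⊆ v jv∈G₀ with adj G j v in jv∈G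
    ... | true  = refl
    ... | false = ⊥-elim (none (v , (j≢v ∘ sym) , jv∈G , subst (1 ≤_) (sym deg-v) 1≤D-v))
      where
      j≢v : j ≢ v
      j≢v = adj⇒≢ G₀∈ jv∈G₀
      deg-v : degree G v ≡ D v
      deg-v = degree-⊖⊖-other {G = G} G≗ j≢v
      1≤D-v : 1 ≤ D v
      1≤D-v = subst (1 ≤_) (ℤ.+-injective (G₀≗D v)) (neighbour⇒1≤degree G₀∈ (trans (adj-sym G₀ v j) jv∈G₀))

  pm-covered-pp-by-path : {G : Graph n} → G ∈ allGraphs n → {i j : Fin n} → i ≢ j → degrees G ≗ Dˢ ⊕ i ⊖ j →
    adj G j i ≡ false → Covered𝒢 pathAndEdgeToggles in𝒟pp G
  pm-covered-pp-by-path {G} G∈ {i} {j} i≢j G≗ ji∉G = cover (⊕⊕-neighbour-of-low-degree G₁∈ G₁≗)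
    where
    G₁ : Graph n
    G₁ = toggle j i G
    G₁∈ : G₁ ∈ allGraphs n
    G₁∈ = toggle-∈-allGraphs j i G
    G₁≗ : degrees G₁ ≗ Dˢ ⊕ i ⊕ i
    G₁≗ k = trans (degrees-add-edge G∈ (i≢j ∘ sym) ji∉G G≗ k) (cancel (Dˢ k) (unit i k) (unit j k))
      where
      cancel : ∀ d a b → d ℤ.+ a ℤ.- b ℤ.+ b ℤ.+ a ≡ d ℤ.+ a ℤ.+ a
      cancel = solve-∀
    cover : (∃ λ w → adj G₁ i w ≡ true × degree G₁ w + 2 ≤ n) → Covered𝒢 pathAndEdgeToggles in𝒟pp G
    cover (w , iw∈G₁ , deg-w) with nonNeighbour-exists G₁∈ w deg-w
    ... | x , x≢w , wx∉G₁ =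
      covered-by-path j i w x (∈.∈-++⁺ˡ (togglePath-∈-pathToggles j i w x)) G∈ (𝒟pp⁺ {E = degrees H} i≢x H≗)
      where
      i≢w : i ≢ w
      i≢w = adj⇒≢ G₁∈ iw∈G₁
      i≢x : i ≢ x
      i≢x refl with trans (sym wx∉G₁) (trans (adj-sym G₁ w i) iw∈G₁)
      ... | ()
      G₂ : Graph n
      G₂ = toggle w x G₁
      iw∈G₂ : adj G₂ i w ≡ true
      iw∈G₂ = trans (adj-toggle-other G₁∈ iw≢wx) iw∈G₁
        where
        iw≢wx : edge i w ≢ edge w x
        iw≢wx eq with edge-injective eq
        ... | inj₁ (i≡w , _) = i≢w i≡w
        ... | inj₂ (i≡x , _) = i≢x i≡x
      H : Graph n
      H = toggle i w G₂
      H≗ : degrees H ≗ Dˢ ⊕ i ⊕ x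
      H≗ k = trans (degrees-remove-edge (toggle-∈-allGraphs w x G₁) iw∈G₂ (degrees-add-edge G₁∈ (x≢w ∘ sym) wx∉G₁ G₁≗) k)
        (cancel (Dˢ k) (unit i k) (unit w k) (unit x k))
        where
        cancel : ∀ d a b c → d ℤ.+ a ℤ.+ a ℤ.+ b ℤ.+ c ℤ.- a ℤ.- b ≡ d ℤ.+ a ℤ.+ c
        cancel = solve-∀

  pm-covered-pp : {G : Graph n} → G ∈ allGraphs n → T (𝒟pm Dˢ (degrees G)) → Covered𝒢 pathAndEdgeToggles in𝒟pp G
  pm-covered-pp {G} G∈ G∈pm with 𝒟pm⁻ {E = degrees G} G∈pm
  ... | i , j , i≢j , G≗ with Fin.any? (λ v → ¬? (v Fin.≟ i) ×-dec ¬? (v Fin.≟ j) ×-dec (adj G j v Bool.≟ false))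
  ...   | yes (v , v≢i , v≢j , jv∉G) =
    covered-by-toggle j v (∈.∈-++⁺ʳ pathToggles (toggle-∈-toggles j v)) G∈
      (𝒟pp⁺ {E = degrees (toggle j v G)} (v≢i ∘ sym) H≗)
    where
    H≗ : degrees (toggle j v G) ≗ Dˢ ⊕ i ⊕ v
    H≗ k = trans (degrees-add-edge G∈ (v≢j ∘ sym) jv∉G G≗ k) (cancel (Dˢ k) (unit i k) (unit j k) (unit v k))
      where
      cancel : ∀ d a b c → d ℤ.+ a ℤ.- b ℤ.+ b ℤ.+ c ≡ d ℤ.+ a ℤ.+ c
      cancel = solve-∀
  ...   | no none = pm-covered-pp-by-path G∈ i≢j G≗ ji∉G
    where
    deg-j : degree G j + 1 ≡ D j
    deg-j = degree-minus {G = G} G≗ (trans (⊖-self (Dˢ ⊕ i) j) (cong (ℤ._- + 1) (⊕-other Dˢ i≢j)))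
    ji∉G : adj G j i ≡ false
    ji∉G with nonNeighbour-exists G∈ j (subst (_≤ n) (trans (cong suc (sym deg-j)) (sym (ℕ.+-suc _ 1))) (D<n j))
    ... | u , u≢j , ju∉G with u Fin.≟ i
    ...   | yes refl = ju∉G
    ...   | no  u≢i  = ⊥-elim (none (u , u≢i , u≢j , ju∉G))

  pm-covered-mm-by-path : {G : Graph n} → G ∈ allGraphs n → {i j : Fin n} → i ≢ j → degrees G ≗ Dˢ ⊕ i ⊖ j →
    adj G i j ≡ true → Covered𝒢 pathAndEdgeToggles in𝒟mm G
  pm-covered-mm-by-path {G} G∈ {i} {j} i≢j G≗ ij∈G = cover (⊖⊖-non-neighbour-of-positive-degree G₁∈ G₁≗)
    where
    G₁ : Graph n
    G₁ = toggle i j G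
    G₁∈ : G₁ ∈ allGraphs n
    G₁∈ = toggle-∈-allGraphs i j G
    G₁≗ : degrees G₁ ≗ Dˢ ⊖ j ⊖ j
    G₁≗ k = trans (degrees-remove-edge G∈ ij∈G G≗ k) (cancel (Dˢ k) (unit i k) (unit j k))
      where
      cancel : ∀ d a b → d ℤ.+ a ℤ.- b ℤ.- a ℤ.- b ≡ d ℤ.- b ℤ.- b
      cancel = solve-∀
    cover : (∃ λ w → w ≢ j × adj G₁ j w ≡ false × 1 ≤ degree G₁ w) → Covered𝒢 pathAndEdgeToggles in𝒟mm G
    cover (w , w≢j , jw∉G₁ , 1≤deg-w) with neighbour-exists G₁∈ w 1≤deg-w
    ... | x , wx∈G₁ =
      covered-by-path i j w x (∈.∈-++⁺ˡ (togglePath-∈-pathToggles i j w x)) G∈ (𝒟mm⁺ {E = degrees H} j≢x H≗)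
      where
      j≢x : j ≢ x
      j≢x refl with trans (sym jw∉G₁) (trans (adj-sym G₁ j w) wx∈G₁)
      ... | ()
      G₂ : Graph n
      G₂ = toggle w x G₁
      jw∉G₂ : adj G₂ j w ≡ false
      jw∉G₂ = trans (adj-toggle-other G₁∈ jw≢wx) jw∉G₁
        where
        jw≢wx : edge j w ≢ edge w x
        jw≢wx eq with edge-injective eq
        ... | inj₁ (j≡w , _) = w≢j (sym j≡w)
        ... | inj₂ (j≡x , _) = j≢x j≡x
      H : Graph n
      H = toggle j w G₂
      H≗ : degrees H ≗ Dˢ ⊖ j ⊖ x
      H≗ k = trans (degrees-add-edge (toggle-∈-allGraphs w x G₁) (w≢j ∘ sym) jw∉G₂ (degrees-remove-edge G₁∈ wx∈G₁ G₁≗) k)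
        (cancel (Dˢ k) (unit j k) (unit w k) (unit x k))
        where
        cancel : ∀ d a b c → d ℤ.- a ℤ.- a ℤ.- b ℤ.- c ℤ.+ a ℤ.+ b ≡ d ℤ.- a ℤ.- c
        cancel = solve-∀

  pm-covered-mm : {G : Graph n} → G ∈ allGraphs n → T (𝒟pm Dˢ (degrees G)) → Covered𝒢 pathAndEdgeToggles in𝒟mm G
  pm-covered-mm {G} G∈ G∈pm with 𝒟pm⁻ {E = degrees G} G∈pm
  ... | i , j , i≢j , G≗ with Fin.any? (λ u → ¬? (u Fin.≟ j) ×-dec (adj G i u Bool.≟ true))
  ...   | yes (u , u≢j , iu∈G) =
    covered-by-toggle i u (∈.∈-++⁺ʳ pathToggles (toggle-∈-toggles i u)) G∈
      (𝒟mm⁺ {E = degrees (toggle i u G)} (u≢j ∘ sym) H≗)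
    where
    H≗ : degrees (toggle i u G) ≗ Dˢ ⊖ j ⊖ u
    H≗ k = trans (degrees-remove-edge G∈ iu∈G G≗ k) (cancel (Dˢ k) (unit i k) (unit j k) (unit u k))
      where
      cancel : ∀ d a b c → d ℤ.+ a ℤ.- b ℤ.- a ℤ.- c ≡ d ℤ.- b ℤ.- c
      cancel = solve-∀
  ...   | no none = pm-covered-mm-by-path G∈ i≢j G≗ ij∈G
    where
    deg-i : degree G i ≡ D i + 1
    deg-i = degree-plus {G = G} G≗ (trans (⊖-other (Dˢ ⊕ i) (i≢j ∘ sym)) (⊕-self Dˢ i))
    ij∈G : adj G i j ≡ true
    ij∈G with neighbour-exists G∈ i (subst (1 ≤_) (sym deg-i) (ℕ.m≤n+m 1 (D i)))
    ... | u , iu∈G with u Fin.≟ j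
    ...   | yes refl = iu∈G
    ...   | no  u≢j  = ⊥-elim (none (u , u≢j , iu∈G))

  private
    bound : {moves : List (Graph n → Graph n)} {P Q : Graph n → Bool} →
      (∀ {G} → G ∈ allGraphs n → T (P G) → Covered𝒢 moves Q G) →
      length (filterᵇ P (allGraphs n)) ≤ length moves * length (filterᵇ Q (allGraphs n))
    bound = covering-bound (allGraphs n) (Unique-subs Unique-pairs) _ _ _

  bound-a : {P : Graph n → Bool} → (∀ {G} → G ∈ allGraphs n → T (P G) → Covered𝒢 toggles in𝒟pm∪D G) →
    length (filterᵇ P (allGraphs n)) ≤ n ^ 2 * (cardGG (𝒟pm Dˢ) + cardG Dˢ)
  bound-a cover = ℕ.≤-trans (bound cover)
    (ℕ.*-mono-≤ (ℕ.≤-reflexive (length-toggles {n})) (length-filter-∨ in𝒟pm (λ H → hasDegrees H Dˢ) (allGraphs n)))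

  bound-b : {P : Graph n → Bool} → (∀ {G} → G ∈ allGraphs n → T (P G) → Covered𝒢 toggles in𝒟pm G) →
    length (filterᵇ P (allGraphs n)) ≤ n ^ 2 * cardGG (𝒟pm Dˢ)
  bound-b {P} cover = subst (λ m → length (filterᵇ P (allGraphs n)) ≤ m * cardGG (𝒟pm Dˢ)) (length-toggles {n}) (bound cover)

  bound-c : {P Q : Graph n → Bool} → (∀ {G} → G ∈ allGraphs n → T (P G) → Covered𝒢 pathAndEdgeToggles Q G) →
    length (filterᵇ P (allGraphs n)) ≤ (n ^ 4 + n ^ 2) * length (filterᵇ Q (allGraphs n))
  bound-c {P} {Q} cover = subst (λ m → length (filterᵇ P (allGraphs n)) ≤ m * length (filterᵇ Q (allGraphs n)))
    (length-pathAndEdgeToggles {n}) (bound cover)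

realisation : {n : ℕ} {D : Fin n → ℕ} → Graphic D → ∃ λ G₀ → G₀ ∈ allGraphs n × degrees G₀ ≗ toSeq D
realisation {n} {D} graphic with ∈-nonempty graphic
... | G₀ , G₀∈ with ∈.∈-filter⁻ (T? ∘ λ G → hasDegrees G (toSeq D)) {xs = allGraphs n} G₀∈
... | G₀∈allGraphs , realises = G₀ , G₀∈allGraphs , hasDegrees⁻ {G = G₀} realises

theorem6p2 : (n : ℕ) (D : Fin n → ℕ) → Graphic D →
    (cardGG (𝒟pp (toSeq D)) ⊔ cardGG (𝒟mm (toSeq D))
       ≤ n ^ 2 * (cardGG (𝒟pm (toSeq D)) + cardG (toSeq D)))
  × (cardGG (𝒟p2 (toSeq D)) ⊔ cardGG (𝒟m2 (toSeq D))
       ≤ n ^ 2 * cardGG (𝒟pm (toSeq D)))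
  × (cardGG (𝒟pm (toSeq D))
       ≤ (n ^ 4 + n ^ 2) * (cardGG (𝒟pp (toSeq D)) ⊓ cardGG (𝒟mm (toSeq D))))
theorem6p2 n D graphic with realisation graphic
... | G₀ , G₀∈ , G₀≗D =
    ℕ.⊔-lub (bound-a pp-covered) (bound-a mm-covered)
  , ℕ.⊔-lub (bound-b p2-covered) (bound-b m2-covered)
  , subst (cardGG (𝒟pm (toSeq D)) ≤_) (sym (ℕ.*-distribˡ-⊓ (n ^ 4 + n ^ 2) (cardGG (𝒟pp (toSeq D))) (cardGG (𝒟mm (toSeq D)))))
      (ℕ.⊓-glb (bound-c pm-covered-pp) (bound-c pm-covered-mm))
  where open Covering D G₀∈ G₀≗D
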